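{- For all integers $n\geqslant 0$ and $k\geqslant 1$, $$(-1)^{k-1} \left( \sum_{j=1}^{k} (-1)^{j-1} p\big(n-j(j+1)/2\big) - D(n) \right) \geqslant 0,$$ with strict inequality if $n\geqslant (k+1)(k+2)/2$. For example, $p(n-1)\geqslant D(n)$, $p(n-1)-p(n-3)\leqslant D(n)$, $p(n-1)-p(n-3)+p(n-6)\geqslant D(n)$, and $p(n-1)-p(n-3)+p(n-6)-p(n-10)\leqslant D(n)$.
   Context: $p(n)$ denotes the number of partitions of $n$, with $p(0)=1$ and $p(n)=0$ if $n$ is not a non-negative integer. The crank of a partition is its largest part if it has no parts equal to $1$, and otherwise is (the number of parts larger than the number of ones) minus (the number of ones). Let $M(m,n)$ be the number of partitions of $n$ with crank $m$, where (following Andrews–Garvan) the values are normalized so that $\sum_{n\geqslant 0}\sum_{m\in\mathbb{Z}} M(m,n)z^mq^n=\frac{(q;q)_\infty}{(zq;q)_\infty(q/z;q)_\infty}$, with $(a;q)_\infty=\prod_{i\geqslant0}(1-aq^i)$ (this agrees with the combinatorial count for $n\neq 1$). $D(n)=\sum_{m>0}M(m,n)$ is the number of partitions of $n$ with positive crank. -}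

module Defs where

open import Data.Nat as ℕ using (ℕ; zero; suc; _∸_; _≤ᵇ_; _≡ᵇ_)
open import Data.Nat.DivMod using (_/_)
open import Data.Integer as ℤ using (ℤ; +_; -[1+_]; -_; _-_; _⊖_)
open import Data.Bool using (Bool; true; false; if_then_else_; _∧_)
open import Data.List using (List; []; _∷_; map; concatMap; filter; length; replicate; _++_; upTo)
import Data.List as L
open import Relation.Nullary.Decidable using (⌊_⌋)
open import Relation.Binary.PropositionalEquality using (_≡_)

-- A partition of n is represented as a non-increasing list of positive parts
-- summing to n.  partsLe k n enumerates (without repetition) all partitions
-- of n whose parts are all ≤ k: choose the multiplicity c of the part k,
-- then recurse on parts ≤ k-1.
partsLe : ℕ → ℕ → List (List ℕ)
partsLe zero zero = [] ∷ []
partsLe zero (suc n) = []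
partsLe (suc k) n =
  concatMap (λ c → map (replicate c (suc k) ++_) (partsLe k (n ∸ c ℕ.* suc k)))
            (L.filterᵇ (λ c → c ℕ.* suc k ≤ᵇ n) (upTo (suc n)))

partitions : ℕ → List (List ℕ)
partitions n = partsLe n n

p : ℕ → ℕ
p n = length (partitions n)

pℤ : ℤ → ℕ
pℤ (+ n) = p n
pℤ -[1+ _ ] = 0

count : (ℕ → Bool) → List ℕ → ℕ
count f xs = length (L.filterᵇ f xs)

largest : List ℕ → ℕ
largest = L.foldr ℕ._⊔_ 0

crank : List ℕ → ℤ
crank λs with count (λ x → x ≡ᵇ 1) λs
... | zero  = + largest λs
... | suc w = count (λ x → suc w ℕ.<ᵇ x) λs ⊖ suc w

Mcomb : ℤ → ℕ → ℤ
Mcomb m n = + length (L.filterᵇ (λ π → ⌊ crank π ℤ.≟ m ⌋) (partitions n))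

-- Andrews–Garvan normalised M(m,n): differs from the combinatorial count
-- only at n = 1, where M(0,1) = -1, M(1,1) = M(-1,1) = 1, all other 0.
M : ℤ → ℕ → ℤ
M m (suc zero) with m
... | + 0        = -[1+ 0 ]
... | + 1        = + 1
... | -[1+ 0 ]   = + 1
... | _          = + 0
M m n = Mcomb m n

sumFrom1 : ℕ → (ℕ → ℤ) → ℤ
sumFrom1 zero f = + 0
sumFrom1 (suc b) f = sumFrom1 b f ℤ.+ f (suc b)

-- D(n) = sum_{m>0} M(m,n).  Since the crank of a partition of n is at most n
-- (and M(m,1) = 0 for m > 1), the terms with m > n vanish, so the sum is
-- truncated at m = n.
D : ℕ → ℤ
D n = sumFrom1 n (λ m → M (+ m) n)

tri : ℕ → ℕ
tri j = (j ℕ.* suc j) / 2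

S : ℕ → ℕ → ℤ
S n k = sumFrom1 k (λ j → (-[1+ 0 ] ℤ.^ (j ∸ 1)) ℤ.* + pℤ (+ n - + tri j))

module Submission where

-- Say that λ = (λ₀ ≥ λ₁ ≥ …) meets diagonal j when the first part with
-- λᵢ ≤ j + i is equal to j + i, and let H_m(n) (`hitCount m n`) count the
-- partitions of n meeting diagonal m + 1.  The proof has three steps.
--  (1) Deleting the hit part and raising the parts before it is a bijection
--      onto the partitions of n − (m+1) missing diagonal m + 2, so
--      H_m(n) + H_{m+1}(n − (m+1)) = p(n − (m+1)).
--  (2) Shaving one cell off each row of the Durfee square and appending as
--      many parts 1 is a bijection from the partitions missing diagonal 1
--      onto those of non-positive crank; hence D(n) = H_0(n) for n ≥ 2, and
--      by inspection for n ≤ 1.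
--  (3) Telescoping (1) along n − T(j) gives D(n) = S(n, k) + (−1)^k H_k(n − T(k)),
--      so the signed gap is H_k(n − T(k)) (`remainder n k`), and a hook
--      makes it positive.

open import Defs
open import Data.Bool using (Bool; true; false; not; T; if_then_else_; _∧_)
open import Data.Bool.Properties using (T-≡; T-not-≡)
open import Data.Integer as ℤ using (ℤ; +_; -[1+_]; _⊖_; _-_; _*_; _^_)
import Data.Integer.Properties as ℤ
open import Data.List using (List; []; _∷_; map; length; replicate; _++_; upTo; filterᵇ; take)
open import Data.List.Properties
  using (++-cancelˡ; ∷-injectiveʳ; length-map; length-++; length-replicate; length-filter; map-∘; map-id-local; filter-none)
open import Data.List.Membership.Propositional using (_∈_)
open import Data.List.Membership.Propositional.Properties
  using (∈-filter⁻; ∈-filter⁺; ∈-map⁻; ∈-map⁺; ∈-concat⁻′; ∈-concat⁺′; ∈-upTo⁺)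
open import Data.List.Membership.Propositional.Properties.WithK using (unique∧set⇒bag)
open import Data.List.Relation.Binary.BagAndSetEquality using (∼bag⇒↭)
open import Data.List.Relation.Binary.Permutation.Propositional.Properties using (↭-length)
open import Data.List.Relation.Binary.Disjoint.Propositional using (Disjoint)
open import Data.List.Relation.Unary.Any using (here; there)
open import Data.List.Relation.Unary.All as All using (All)
import Data.List.Relation.Unary.AllPairs as AllPairs
import Data.List.Relation.Unary.AllPairs.Properties as AllPairs
import Data.List.Relation.Unary.All.Properties as All
open import Data.List.Relation.Unary.Unique.Propositional using (Unique)
import Data.List.Relation.Unary.Unique.Propositional.Properties as Unique
open import Data.Nat as ℕ using (ℕ; zero; suc; pred; _∸_; _+_; _≤_; _<_; z≤n; s≤s; _≤ᵇ_; _<ᵇ_; _≡ᵇ_)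
open import Data.Nat.ListAction using (sum)
open import Data.Nat.ListAction.Properties using (sum-++)
open import Data.Nat.Properties
open import Data.Nat.Solver using (module +-*-Solver)
open import Data.Nat.DivMod using (_/_; +-distrib-/-∣ʳ; m*n/n≡m)
open import Data.Nat.Divisibility using (divides)
open import Data.Integer.Solver using () renaming (module +-*-Solver to ℤSolver)
open import Data.Product using (_×_; _,_; Σ; proj₁; proj₂)
open import Function using (_∘_; mk⇔; Equivalence)
open import Relation.Nullary using (¬_; Dec; does; _because_; yes; no; contradiction)
open import Relation.Nullary.Decidable using (T?; ⌊_⌋)
open import Relation.Nullary.Reflects using (ofʸ; ofⁿ)
open import Relation.Binary.PropositionalEquality

indicator : Bool → ℕ
indicator true  = 1
indicator false = 0

module _ {A : Set} where

  countBy : (A → Bool) → List A → ℕ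
  countBy p xs = length (filterᵇ p xs)

  countBy-∷ : ∀ (p : A → Bool) x xs → countBy p (x ∷ xs) ≡ indicator (p x) + countBy p xs
  countBy-∷ p x xs with p x
  ... | true  = refl
  ... | false = refl

  countBy-split : ∀ (p q r : A → Bool) xs →
                  (∀ x → indicator (p x) ≡ indicator (q x) + indicator (r x)) →
                  countBy p xs ≡ countBy q xs + countBy r xs
  countBy-split p q r [] _ = refl
  countBy-split p q r (x ∷ xs) split = begin
    countBy p (x ∷ xs)                                                 ≡⟨ countBy-∷ p x xs ⟩
    indicator (p x) + countBy p xs                                     ≡⟨ cong₂ _+_ (split x) (countBy-split p q r xs split) ⟩
    (indicator (q x) + indicator (r x)) + (countBy q xs + countBy r xs) ≡⟨ +-interchange (indicator (q x)) (indicator (r x)) (countBy q xs) (countBy r xs) ⟩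
    (indicator (q x) + countBy q xs) + (indicator (r x) + countBy r xs) ≡⟨ cong₂ _+_ (countBy-∷ q x xs) (countBy-∷ r x xs) ⟨
    countBy q (x ∷ xs) + countBy r (x ∷ xs)                            ∎
    where
    open ≡-Reasoning
    +-interchange : ∀ a b c d → (a + b) + (c + d) ≡ (a + c) + (b + d)
    +-interchange = solve 4 (λ a b c d → (a :+ b) :+ (c :+ d) := (a :+ c) :+ (b :+ d)) refl
      where open +-*-Solver

  countBy-complement : ∀ (p : A → Bool) xs →
                       countBy p xs + countBy (not ∘ p) xs ≡ length xs
  countBy-complement p [] = refl
  countBy-complement p (x ∷ xs) with p x
  ... | true  = cong suc (countBy-complement p xs)
  ... | false = trans (+-suc _ _) (cong suc (countBy-complement p xs))

  countBy-cong : ∀ (p q : A → Bool) xs → (∀ {x} → x ∈ xs → p x ≡ q x) →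
                 countBy p xs ≡ countBy q xs
  countBy-cong p q [] agree = refl
  countBy-cong p q (x ∷ xs) agree with p x | q x | agree (here refl)
  ... | true  | true  | _ = cong suc (countBy-cong p q xs (agree ∘ there))
  ... | false | false | _ = countBy-cong p q xs (agree ∘ there)

  countBy-++ : ∀ (p : A → Bool) u v → countBy p (u ++ v) ≡ countBy p u + countBy p v
  countBy-++ p []      v = refl
  countBy-++ p (x ∷ u) v with p x
  ... | true  = cong suc (countBy-++ p u v)
  ... | false = countBy-++ p u v

  countBy-none : ∀ (p : A → Bool) xs → (∀ {x} → x ∈ xs → ¬ T (p x)) → countBy p xs ≡ 0
  countBy-none p xs none = cong length (filter-none (T? ∘ p) (All.tabulate none))

  countBy-positive : ∀ (p : A → Bool) {x} xs → x ∈ xs → T (p x) → 1 ≤ countBy p xs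
  countBy-positive p xs x∈xs px = nonempty (∈-filter⁺ (T? ∘ p) x∈xs px)
    where
    nonempty : ∀ {x ys} → x ∈ ys → 1 ≤ length ys
    nonempty (here _)  = s≤s z≤n
    nonempty (there _) = s≤s z≤n

  unique-map : ∀ {xs} (f g : A → A) → (∀ {x} → x ∈ xs → g (f x) ≡ x) →
               Unique xs → Unique (map f xs)
  unique-map {xs} f g retract u = Unique.map⁻ {f = g} (subst Unique gfxs≡xs u)
    where
    gfxs≡xs : xs ≡ map g (map f xs)
    gfxs≡xs = sym (trans (sym (map-∘ xs)) (map-id-local (All.tabulate retract)))

  countBy-bijection : ∀ (p q : A → Bool) {xs ys} → Unique xs → Unique ys →
    (f g : A → A) →
    (∀ {x} → x ∈ xs → T (p x) → f x ∈ ys × T (q (f x))) →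
    (∀ {y} → y ∈ ys → T (q y) → g y ∈ xs × T (p (g y))) →
    (∀ {x} → x ∈ xs → T (p x) → g (f x) ≡ x) →
    (∀ {y} → y ∈ ys → T (q y) → f (g y) ≡ y) →
    countBy p xs ≡ countBy q ys
  countBy-bijection p q {xs} {ys} uxs uys f g f∈ g∈ gf fg = begin
    length (filterᵇ p xs)         ≡⟨ sym (length-map f (filterᵇ p xs)) ⟩
    length (map f (filterᵇ p xs)) ≡⟨ ↭-length (∼bag⇒↭ (unique∧set⇒bag uImage uTarget (mk⇔ to from))) ⟩
    length (filterᵇ q ys)         ∎
    where
    open ≡-Reasoning
    uImage : Unique (map f (filterᵇ p xs))
    uImage = unique-map f g (λ x∈ → let x∈xs , px = ∈-filter⁻ (T? ∘ p) x∈ in gf x∈xs px)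
                        (Unique.filter⁺ (T? ∘ p) uxs)
    uTarget : Unique (filterᵇ q ys)
    uTarget = Unique.filter⁺ (T? ∘ q) uys
    to : ∀ {z} → z ∈ map f (filterᵇ p xs) → z ∈ filterᵇ q ys
    to z∈ with x , x∈ , refl ← ∈-map⁻ f z∈ =
      let x∈xs , px = ∈-filter⁻ (T? ∘ p) x∈ ; fx∈ys , qfx = f∈ x∈xs px
      in ∈-filter⁺ (T? ∘ q) fx∈ys qfx
    from : ∀ {z} → z ∈ filterᵇ q ys → z ∈ map f (filterᵇ p xs)
    from {z} z∈ =
      let z∈ys , qz = ∈-filter⁻ (T? ∘ q) z∈ ; gz∈xs , pgz = g∈ z∈ys qz
      in subst (_∈ map f (filterᵇ p xs)) (fg z∈ys qz) (∈-map⁺ f (∈-filter⁺ (T? ∘ p) gz∈xs pgz))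

<ᵇ-true : ∀ {m n} → m < n → (m <ᵇ n) ≡ true
<ᵇ-true m<n = Equivalence.to T-≡ (<⇒<ᵇ m<n)

<ᵇ-false : ∀ {m n} → n ≤ m → (m <ᵇ n) ≡ false
<ᵇ-false {m} {n} n≤m with m <ᵇ n | <ᵇ-reflects-< m n
... | true  | ofʸ m<n = contradiction m<n (≤⇒≯ n≤m)
... | false | _       = refl

<ᵇ-false⁻ : ∀ {m n} → (m <ᵇ n) ≡ false → n ≤ m
<ᵇ-false⁻ eq = ≮⇒≥ (λ m<n → contradiction (trans (sym (<ᵇ-true m<n)) eq) λ ())

≡ᵇ-refl : ∀ n → (n ≡ᵇ n) ≡ true
≡ᵇ-refl n = Equivalence.to T-≡ (≡⇒≡ᵇ n n refl)

≡ᵇ-false : ∀ {m n} → m ≢ n → (m ≡ᵇ n) ≡ false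
≡ᵇ-false {m} {n} m≢n with m ≡ᵇ n in eq
... | true  = contradiction (≡ᵇ⇒≡ m n (Equivalence.from T-≡ eq)) m≢n
... | false = refl

-- Partitions as lists.  `Bounded b π`: π is a non-increasing list of positive
-- parts, all at most b.  The partitions of n are the bounded lists of sum n.
data Bounded : ℕ → List ℕ → Set where
  bnil  : ∀ {b} → Bounded b []
  bcons : ∀ {b x xs} → 1 ≤ x → x ≤ b → Bounded x xs → Bounded b (x ∷ xs)

Bounded-weaken : ∀ {b c xs} → b ≤ c → Bounded b xs → Bounded c xs
Bounded-weaken b≤c bnil            = bnil
Bounded-weaken b≤c (bcons p x≤b r) = bcons p (≤-trans x≤b b≤c) r

Bounded-sum : ∀ {b xs} → Bounded b xs → Bounded (sum xs) xs
Bounded-sum bnil                       = bnil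
Bounded-sum (bcons {x = x} {xs} p _ r) = bcons p (m≤m+n x (sum xs)) r

Bounded-replicate : ∀ {b} c a xs → 1 ≤ a → a ≤ b → Bounded a xs →
                    Bounded b (replicate c a ++ xs)
Bounded-replicate zero    a xs p a≤b r = Bounded-weaken a≤b r
Bounded-replicate (suc c) a xs p a≤b r = bcons p a≤b (Bounded-replicate c a xs p ≤-refl r)

sum-replicate : ∀ c a → sum (replicate c a) ≡ c ℕ.* a
sum-replicate zero    a = refl
sum-replicate (suc c) a = cong (_+_ a) (sum-replicate c a)

Bounded-∈ : ∀ {b xs y} → Bounded b xs → y ∈ xs → y ≤ b
Bounded-∈ (bcons _ y≤b _) (here refl) = y≤b
Bounded-∈ (bcons _ x≤b r) (there y∈)  = ≤-trans (Bounded-∈ r y∈) x≤b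

Bounded-++-ones : ∀ {b} u c → Bounded b u → 1 ≤ b → Bounded b (u ++ replicate c 1)
Bounded-++-ones []      zero    bnil          _   = bnil
Bounded-++-ones []      (suc c) bnil          1≤b = bcons ≤-refl 1≤b (Bounded-++-ones [] c bnil ≤-refl)
Bounded-++-ones (x ∷ u) c       (bcons p q r) _   = bcons p q (Bounded-++-ones u c r p)

sum-ones : ∀ c → sum (replicate c 1) ≡ c
sum-ones c = trans (sum-replicate c 1) (*-identityʳ c)

Bounded-prefix : ∀ {b} u v → Bounded b (u ++ v) → Bounded b u
Bounded-prefix []      v _             = bnil
Bounded-prefix (x ∷ u) v (bcons p q r) = bcons p q (Bounded-prefix u v r)

block : ℕ → ℕ → ℕ → List (List ℕ)
block k n c = map (replicate c (suc k) ++_) (partsLe k (n ∸ c ℕ.* suc k))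

multiplicities : ℕ → ℕ → List ℕ
multiplicities k n = filterᵇ (λ c → c ℕ.* suc k ≤ᵇ n) (upTo (suc n))

partsLe-sound : ∀ k n π → π ∈ partsLe k n → Bounded k π × sum π ≡ n
partsLe-sound zero zero .[] (here refl) = bnil , refl
partsLe-sound (suc k) n π π∈
  with vs , π∈vs , vs∈ ← ∈-concat⁻′ (map (block k n) (multiplicities k n)) π∈
  with c , c∈ , refl ← ∈-map⁻ (block k n) vs∈
  with r , r∈ , refl ← ∈-map⁻ (replicate c (suc k) ++_) π∈vs
  with bounded , sumr ← partsLe-sound k _ r r∈ =
  Bounded-replicate c (suc k) r (s≤s z≤n) ≤-refl (Bounded-weaken (n≤1+n k) bounded) ,
  (begin
    sum (replicate c (suc k) ++ r)         ≡⟨ sum-++ (replicate c (suc k)) r ⟩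
    sum (replicate c (suc k)) + sum r      ≡⟨ cong₂ _+_ (sum-replicate c (suc k)) sumr ⟩
    c ℕ.* suc k + (n ∸ c ℕ.* suc k)        ≡⟨ m+[n∸m]≡n c*k≤n ⟩
    n                                      ∎)
  where
  open ≡-Reasoning
  c*k≤n : c ℕ.* suc k ≤ n
  c*k≤n = ≤ᵇ⇒≤ _ _ (proj₂ (∈-filter⁻ (λ c → T? (c ℕ.* suc k ≤ᵇ n)) {xs = upTo (suc n)} c∈))

split : ∀ {k π} → Bounded (suc k) π →
        Σ ℕ λ c → Σ (List ℕ) λ r → (π ≡ replicate c (suc k) ++ r) × Bounded k r
split bnil = 0 , [] , refl , bnil
split {k} (bcons {x = x} {xs} p x≤ r) with x ℕ.≟ suc k
... | yes refl with c , r' , eq , bounded ← split r = suc c , r' , cong (suc k ∷_) eq , bounded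
... | no x≢ = 0 , x ∷ xs , refl , bcons p (≤-pred (≤∧≢⇒< x≤ x≢)) r

partsLe-complete : ∀ k n π → Bounded k π → sum π ≡ n → π ∈ partsLe k n
partsLe-complete zero zero    []      bnil          _  = here refl
partsLe-complete zero (suc n) []      bnil          ()
partsLe-complete zero n       (x ∷ π) (bcons p q r) _  = contradiction q (<⇒≱ p)
partsLe-complete (suc k) n π bounded sumπ with split bounded
... | c , r , refl , boundedr = ∈-concat⁺′ π∈block (∈-map⁺ (block k n) c∈)
  where
  sumSplit : c ℕ.* suc k + sum r ≡ n
  sumSplit = trans (cong (_+ sum r) (sym (sum-replicate c (suc k))))
                   (trans (sym (sum-++ (replicate c (suc k)) r)) sumπ)
  c*k≤n : c ℕ.* suc k ≤ n
  c*k≤n = subst (c ℕ.* suc k ≤_) sumSplit (m≤m+n _ _)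
  sumr : sum r ≡ n ∸ c ℕ.* suc k
  sumr = sym (trans (cong (_∸ c ℕ.* suc k) (sym sumSplit)) (m+n∸m≡n (c ℕ.* suc k) (sum r)))
  π∈block : replicate c (suc k) ++ r ∈ block k n c
  π∈block = ∈-map⁺ (replicate c (suc k) ++_) (partsLe-complete k _ r boundedr sumr)
  c∈ : c ∈ multiplicities k n
  c∈ = ∈-filter⁺ (λ c → T? (c ℕ.* suc k ≤ᵇ n))
         (∈-upTo⁺ (s≤s (≤-trans (m≤m*n c (suc k)) c*k≤n))) (≤⇒≤ᵇ c*k≤n)

multiplicity-unique : ∀ {k r r'} c c' → Bounded k r → Bounded k r' →
  replicate c (suc k) ++ r ≡ replicate c' (suc k) ++ r' → c ≡ c'
multiplicity-unique zero     zero     _             _             _  = refl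
multiplicity-unique zero     (suc c') (bcons _ q _) _             refl = contradiction q (<-irrefl refl)
multiplicity-unique (suc c)  zero     _             (bcons _ q _) refl = contradiction q (<-irrefl refl)
multiplicity-unique (suc c)  (suc c') r             r'            eq =
  cong suc (multiplicity-unique c c' r r' (∷-injectiveʳ eq))

-- partsLe k n has no repetitions: distinct blocks have distinct multiplicities
partsLe-unique : ∀ k n → Unique (partsLe k n)
partsLe-unique zero    zero    = All.[] AllPairs.∷ AllPairs.[]
partsLe-unique zero    (suc n) = AllPairs.[]
partsLe-unique (suc k) n = Unique.concat⁺ blocksUnique blocksDisjoint
  where
  blocksUnique : All Unique (map (block k n) (multiplicities k n))
  blocksUnique = All.map⁺ (All.tabulate λ {c} _ →
    Unique.map⁺ (λ {x} {y} → ++-cancelˡ (replicate c (suc k)) x y) (partsLe-unique k _))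
  disjoint : ∀ {c c'} → c ≢ c' → Disjoint (block k n c) (block k n c')
  disjoint {c} {c'} c≢c' (π∈ , π∈')
    with r  , r∈  , refl ← ∈-map⁻ (replicate c (suc k) ++_) π∈
    with r' , r'∈ , eq   ← ∈-map⁻ (replicate c' (suc k) ++_) π∈'
    = c≢c' (multiplicity-unique c c' (proj₁ (partsLe-sound k _ r r∈)) (proj₁ (partsLe-sound k _ r' r'∈)) eq)
  blocksDisjoint : AllPairs.AllPairs Disjoint (map (block k n) (multiplicities k n))
  blocksDisjoint = AllPairs.map⁺ (AllPairs.map disjoint
    (Unique.filter⁺ (λ c → T? (c ℕ.* suc k ≤ᵇ n)) (Unique.upTo⁺ (suc n))))

partitions-sound : ∀ {π} n → π ∈ partitions n → Bounded n π × sum π ≡ n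
partitions-sound {π} n = partsLe-sound n n π

partitions-complete : ∀ {b π n} → Bounded b π → sum π ≡ n → π ∈ partitions n
partitions-complete {π = π} {n} bounded refl = partsLe-complete n n π (Bounded-sum bounded) refl

partitions-unique : ∀ n → Unique (partitions n)
partitions-unique n = partsLe-unique n n

-- The diagonal statistic.  `meets j λ` holds when, scanning λ₀ ≥ λ₁ ≥ …, the
-- first part λᵢ with λᵢ ≤ j + i exists and is equal to j + i.
meets : ℕ → List ℕ → Bool
meets j []       = false
meets j (x ∷ xs) = if j <ᵇ x then meets (suc j) xs else x ≡ᵇ j

-- For λ meeting diagonal j: raise the parts before the hit by one and delete
-- the hit part λᵢ = j + i.  This lowers the size by exactly j.
removeHit : ℕ → List ℕ → List ℕ
removeHit j []       = []
removeHit j (x ∷ xs) = if j <ᵇ x then suc x ∷ removeHit (suc j) xs else xs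

insertHit : ℕ → List ℕ → List ℕ
insertHit j []       = j ∷ []
insertHit j (y ∷ ys) = if suc j <ᵇ y then pred y ∷ insertHit (suc j) ys else j ∷ y ∷ ys

meets-bounded : ∀ {j xs} → Bounded j xs → meets (suc j) xs ≡ false
meets-bounded bnil = refl
meets-bounded {j} (bcons {x = y} _ y≤j _)
  rewrite <ᵇ-false {suc j} {y} (≤-trans y≤j (n≤1+n j)) = ≡ᵇ-false (<⇒≢ (s≤s y≤j))

removeHit-sum : ∀ j λs → T (meets j λs) → sum (removeHit j λs) + j ≡ sum λs
removeHit-sum j (x ∷ xs) hit with j <ᵇ x
... | true  = begin
  suc x + sum (removeHit (suc j) xs) + j   ≡⟨ shuffle x (sum (removeHit (suc j) xs)) j ⟩
  x + (sum (removeHit (suc j) xs) + suc j) ≡⟨ cong (_+_ x) (removeHit-sum (suc j) xs hit) ⟩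
  x + sum xs                               ∎
  where
  open ≡-Reasoning
  shuffle : ∀ a b c → suc a + b + c ≡ a + (b + suc c)
  shuffle = solve 3 (λ a b c → (con 1 :+ a) :+ b :+ c := a :+ (b :+ (con 1 :+ c))) refl
    where open +-*-Solver
... | false with refl ← ≡ᵇ⇒≡ x j hit = +-comm (sum xs) x

removeHit-bounded : ∀ {b} j λs → Bounded b λs → T (meets j λs) → Bounded (suc b) (removeHit j λs)
removeHit-bounded j (x ∷ xs) (bcons p x≤b r) hit with j <ᵇ x
... | true  = bcons (s≤s z≤n) (s≤s x≤b) (removeHit-bounded (suc j) xs r hit)
... | false = Bounded-weaken (≤-trans x≤b (n≤1+n _)) r

removeHit-misses : ∀ {b} j λs → Bounded b λs → T (meets j λs) →
                   meets (suc j) (removeHit j λs) ≡ false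
removeHit-misses j (x ∷ xs) (bcons _ _ r) hit with j <ᵇ x in j<ᵇx
... | true rewrite j<ᵇx = removeHit-misses (suc j) xs r hit
... | false with refl ← ≡ᵇ⇒≡ x j hit = meets-bounded r

insertHit-removeHit : ∀ {b} j λs → Bounded b λs → T (meets j λs) →
                      insertHit j (removeHit j λs) ≡ λs
insertHit-removeHit j (x ∷ xs) (bcons _ _ r) hit with j <ᵇ x in j<ᵇx
... | true rewrite j<ᵇx = cong (x ∷_) (insertHit-removeHit (suc j) xs r hit)
... | false with refl ← ≡ᵇ⇒≡ x j hit with xs | r
...   | []     | _                 = refl
...   | y ∷ ys | bcons _ y≤j _ rewrite <ᵇ-false {suc j} {y} (≤-trans y≤j (n≤1+n j)) = refl

insertHit-sum : ∀ j σ → sum (insertHit j σ) ≡ j + sum σ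
insertHit-sum j []       = refl
insertHit-sum j (y ∷ ys) with suc j <ᵇ y | <ᵇ-reflects-< (suc j) y
... | false | _ = refl
... | true  | ofʸ (s≤s (s≤s {n = y'} _)) = begin
  suc y' + sum (insertHit (suc j) ys) ≡⟨ cong (_+_ (suc y')) (insertHit-sum (suc j) ys) ⟩
  suc y' + (suc j + sum ys)           ≡⟨ shuffle y' j (sum ys) ⟩
  j + (suc (suc y') + sum ys)         ∎
  where
  open ≡-Reasoning
  shuffle : ∀ a b c → suc a + (suc b + c) ≡ b + (suc (suc a) + c)
  shuffle = solve 3 (λ a b c → (con 1 :+ a) :+ ((con 1 :+ b) :+ c) := b :+ ((con 2 :+ a) :+ c)) refl
    where open +-*-Solver

meets-front : ∀ j xs → T (meets j (j ∷ xs))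
meets-front j xs rewrite <ᵇ-false {j} {j} ≤-refl | ≡ᵇ-refl j = _

insertHit-meets : ∀ j σ → meets (suc j) σ ≡ false → T (meets j (insertHit j σ))
insertHit-meets j []       _      = meets-front j []
insertHit-meets j (y ∷ ys) misses with suc j <ᵇ y | <ᵇ-reflects-< (suc j) y
... | false | _ = meets-front j (y ∷ ys)
... | true  | ofʸ (s≤s (s≤s j≤y')) rewrite <ᵇ-true (s≤s j≤y') = insertHit-meets (suc j) ys misses

removeHit-insertHit : ∀ j σ → meets (suc j) σ ≡ false → removeHit j (insertHit j σ) ≡ σ
removeHit-insertHit j [] _ rewrite <ᵇ-false {j} {j} ≤-refl = refl
removeHit-insertHit j (y ∷ ys) misses with suc j <ᵇ y | <ᵇ-reflects-< (suc j) y
... | false | _ rewrite <ᵇ-false {j} {j} ≤-refl = refl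
... | true  | ofʸ (s≤s (s≤s {n = y'} j≤y')) rewrite <ᵇ-true (s≤s j≤y') =
  cong (suc (suc y') ∷_) (removeHit-insertHit (suc j) ys misses)

insertHit-bounded : ∀ {c} j σ → 1 ≤ j → j ≤ c → Bounded (suc c) σ → meets (suc j) σ ≡ false →
                    Bounded c (insertHit j σ)
insertHit-bounded j [] 1≤j j≤c bnil _ = bcons 1≤j j≤c bnil
insertHit-bounded j (y ∷ ys) 1≤j j≤c (bcons p y≤ r) misses
  with suc j <ᵇ y | <ᵇ-reflects-< (suc j) y
... | true  | ofʸ (s≤s (s≤s j≤y')) =
  bcons (s≤s z≤n) (≤-pred y≤) (insertHit-bounded (suc j) ys (s≤s z≤n) (s≤s j≤y') r misses)
... | false | ofⁿ y≤1+j = bcons 1≤j j≤c (bcons p y≤j r)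
  where
  y≢1+j : y ≢ suc j
  y≢1+j refl = contradiction (trans (sym (≡ᵇ-refl (suc j))) misses) λ ()
  y≤j : y ≤ j
  y≤j = ≤-pred (≤∧≢⇒< (≮⇒≥ y≤1+j) y≢1+j)

meets-size : ∀ j λs → T (meets j λs) → j ≤ sum λs
meets-size j (x ∷ xs) hit with j <ᵇ x
... | true  = ≤-trans (n≤1+n j) (≤-trans (meets-size (suc j) xs hit) (m≤n+m (sum xs) x))
... | false with refl ← ≡ᵇ⇒≡ x j hit = m≤m+n x (sum xs)

hitCount : ℕ → ℕ → ℕ
hitCount m n = countBy (meets (suc m)) (partitions n)

-- removeHit/insertHit match the partitions of (m+1) + M meeting diagonal m+1
-- with the partitions of M missing diagonal m+2.
hitCount-recursion : ∀ m M → hitCount m (suc m + M) + hitCount (suc m) M ≡ p M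
hitCount-recursion m M = begin
  hitCount m (j + M) + hitCount (suc m) M       ≡⟨ cong (_+ hitCount (suc m) M) removeHit-bijection ⟩
  countBy (not ∘ meets (suc j)) (partitions M)
    + countBy (meets (suc j)) (partitions M)    ≡⟨ +-comm _ (hitCount (suc m) M) ⟩
  countBy (meets (suc j)) (partitions M)
    + countBy (not ∘ meets (suc j)) (partitions M) ≡⟨ countBy-complement (meets (suc j)) (partitions M) ⟩
  p M                                           ∎
  where
  open ≡-Reasoning
  j : ℕ
  j = suc m
  forward : ∀ {λs} → λs ∈ partitions (j + M) → T (meets j λs) →
            removeHit j λs ∈ partitions M × T (not (meets (suc j) (removeHit j λs)))
  forward {λs} λs∈ hit =
    let bounded , sumλs = partitions-sound (j + M) λs∈ in
    partitions-complete (removeHit-bounded j λs bounded hit)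
      (+-cancelʳ-≡ j _ _ (trans (removeHit-sum j λs hit) (trans sumλs (+-comm j M)))) ,
    Equivalence.from T-not-≡ (removeHit-misses j λs bounded hit)
  backward : ∀ {σ} → σ ∈ partitions M → T (not (meets (suc j) σ)) →
             insertHit j σ ∈ partitions (j + M) × T (meets j (insertHit j σ))
  backward {σ} σ∈ miss =
    let bounded , sumσ = partitions-sound M σ∈
        misses = Equivalence.to T-not-≡ miss in
    partitions-complete
      (insertHit-bounded j σ (s≤s z≤n) (m≤n+m j M)
        (Bounded-weaken (≤-trans (m≤m+n M j) (n≤1+n _)) bounded) misses)
      (trans (insertHit-sum j σ) (cong (_+_ j) sumσ)) ,
    insertHit-meets j σ misses
  removeHit-bijection : hitCount m (j + M) ≡ countBy (not ∘ meets (suc j)) (partitions M)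
  removeHit-bijection =
    countBy-bijection (meets j) (not ∘ meets (suc j)) (partitions-unique (j + M)) (partitions-unique M)
      (removeHit j) (insertHit j) forward backward
      (λ λs∈ hit → insertHit-removeHit j _ (proj₁ (partitions-sound (j + M) λs∈)) hit)
      (λ _ miss → removeHit-insertHit j _ (Equivalence.to T-not-≡ miss))

hitCount-small : ∀ m n → n < suc m → hitCount m n ≡ 0
hitCount-small m n n<1+m = countBy-none (meets (suc m)) (partitions n) λ {λs} λs∈ hit →
  <⇒≱ n<1+m (subst (suc m ≤_) (proj₂ (partitions-sound n λs∈)) (meets-size (suc m) λs hit))

-- the hook (m+1, 1, …, 1) of size n ≥ m + 1 meets diagonal m + 1
hitCount-positive : ∀ m n → suc m ≤ n → 1 ≤ hitCount m n
hitCount-positive m n m<n =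
  countBy-positive (meets (suc m)) (partitions n) hook∈ (meets-front (suc m) (replicate (n ∸ suc m) 1))
  where
  hook : List ℕ
  hook = suc m ∷ replicate (n ∸ suc m) 1
  hook∈ : hook ∈ partitions n
  hook∈ = partitions-complete
    (Bounded-++-ones (suc m ∷ []) (n ∸ suc m) (bcons (s≤s z≤n) ≤-refl bnil) (s≤s z≤n))
    (trans (cong (_+_ (suc m)) (sum-ones (n ∸ suc m))) (m+[n∸m]≡n m<n))

-- The crank via the Durfee square.  `part i λ` is λᵢ (0 beyond the end),
-- `durfee j λ` the number of leading parts with λᵢ > j + i (so durfee 0 λ
-- is the side of the Durfee square) and `above t λ` the number of parts > t.
part : ℕ → List ℕ → ℕ
part i       []       = 0
part zero    (x ∷ xs) = x
part (suc i) (x ∷ xs) = part i xs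

durfee : ℕ → List ℕ → ℕ
durfee j []       = 0
durfee j (x ∷ xs) = if j <ᵇ x then suc (durfee (suc j) xs) else 0

above : ℕ → List ℕ → ℕ
above t = count (λ y → t <ᵇ y)

part-≤-head : ∀ {b x xs} i → Bounded b (x ∷ xs) → part i (x ∷ xs) ≤ x
part-≤-head zero    _             = ≤-refl
part-≤-head (suc i) (bcons _ _ r) = part-≤ i r
  where
  part-≤ : ∀ {b xs} i → Bounded b xs → part i xs ≤ b
  part-≤ i       bnil            = z≤n
  part-≤ zero    (bcons _ x≤b _) = x≤b
  part-≤ (suc i) (bcons _ x≤b r) = ≤-trans (part-≤ i r) x≤b

durfee≤⇒part : ∀ {b} j t xs → Bounded b xs → durfee j xs ≤ t → part t xs ≤ j + t
durfee≤⇒part j t [] _ _ = z≤n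
durfee≤⇒part j t (x ∷ xs) bounded@(bcons _ _ r) d≤t with j <ᵇ x | <ᵇ-reflects-< j x
durfee≤⇒part j (suc t) (x ∷ xs) (bcons _ _ r) (s≤s d≤t) | true | _ =
  subst (part t xs ≤_) (sym (+-suc j t)) (durfee≤⇒part (suc j) t xs r d≤t)
... | false | ofⁿ j≮x = ≤-trans (part-≤-head t bounded) (≤-trans (≮⇒≥ j≮x) (m≤m+n j t))

part⇒durfee≤ : ∀ j t xs → part t xs ≤ j + t → durfee j xs ≤ t
part⇒durfee≤ j t [] _ = z≤n
part⇒durfee≤ j t (x ∷ xs) x≤ with j <ᵇ x | <ᵇ-reflects-< j x
part⇒durfee≤ j zero    (x ∷ xs) x≤  | true | ofʸ j<x = contradiction (subst (x ≤_) (+-identityʳ j) x≤) (<⇒≱ j<x)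
part⇒durfee≤ j (suc t) (x ∷ xs) xs≤ | true | _ = s≤s (part⇒durfee≤ (suc j) t xs (subst (part t xs ≤_) (+-suc j t) xs≤))
... | false | _ = z≤n

above≤⇒part : ∀ {b} t s xs → Bounded b xs → above t xs ≤ s → part s xs ≤ t
above≤⇒part t s [] _ _ = z≤n
above≤⇒part t s (x ∷ xs) bounded@(bcons _ _ r) a≤s with t <ᵇ x | <ᵇ-reflects-< t x
above≤⇒part t (suc s) (x ∷ xs) (bcons _ _ r) (s≤s a≤s) | true | _ = above≤⇒part t s xs r a≤s
... | false | ofⁿ t≮x = ≤-trans (part-≤-head s bounded) (≮⇒≥ t≮x)

part⇒above≤ : ∀ {b} t s xs → Bounded b xs → part s xs ≤ t → above t xs ≤ s
part⇒above≤ t s [] _ _ = z≤n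
part⇒above≤ t s (x ∷ xs) (bcons _ _ r) x≤t with t <ᵇ x | <ᵇ-reflects-< t x
part⇒above≤ t zero    (x ∷ xs) _             x≤t | true  | ofʸ t<x = contradiction t<x (≤⇒≯ x≤t)
part⇒above≤ t (suc s) (x ∷ xs) (bcons _ _ r) xs≤ | true  | _       = s≤s (part⇒above≤ t s xs r xs≤)
part⇒above≤ t s       (x ∷ xs) (bcons _ _ r) _   | false | ofⁿ t≮x =
  ≤-trans (≤-reflexive (countBy-none _ xs (λ y∈ t<y → t≮x (<-≤-trans (<ᵇ⇒< t _ t<y) (Bounded-∈ r y∈))))) z≤n

<ᵇ-agree : ∀ {a c} t → (a ≤ t → c ≤ t) → (c ≤ t → a ≤ t) → (t <ᵇ a) ≡ (t <ᵇ c)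
<ᵇ-agree {a} {c} t a⇒c c⇒a with t <ᵇ a | <ᵇ-reflects-< t a | t <ᵇ c | <ᵇ-reflects-< t c
... | true  | _       | true  | _       = refl
... | false | _       | false | _       = refl
... | true  | ofʸ t<a | false | ofⁿ t≮c = contradiction (c⇒a (≮⇒≥ t≮c)) (<⇒≱ t<a)
... | false | ofⁿ t≮a | true  | ofʸ t<c = contradiction (a⇒c (≮⇒≥ t≮a)) (<⇒≱ t<c)

isPositive : ℤ → Bool
isPositive (+ suc _) = true
isPositive _         = false

isPositive-⊖ : ∀ a c → isPositive (a ⊖ c) ≡ (c <ᵇ a)
isPositive-⊖ zero    zero    = refl
isPositive-⊖ zero    (suc c) = refl
isPositive-⊖ (suc a) zero    = refl
isPositive-⊖ (suc a) (suc c) = trans (cong isPositive (ℤ.[1+m]⊖[1+n]≡m⊖n a c)) (isPositive-⊖ a c)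

ones : List ℕ → ℕ
ones = count (λ x → x ≡ᵇ 1)

positiveCrank : List ℕ → Bool
positiveCrank π = isPositive (crank π)

positiveCrank-durfee : ∀ {b} π → Bounded b π → positiveCrank π ≡ (ones π <ᵇ durfee 0 π)
positiveCrank-durfee π bounded with count (λ x → x ≡ᵇ 1) π
positiveCrank-durfee [] bnil | zero = refl
positiveCrank-durfee (zero ∷ xs) (bcons () _ _) | zero
positiveCrank-durfee (suc x ∷ xs) (bcons _ _ _) | zero with largest xs
... | zero  = refl
... | suc _ = refl
positiveCrank-durfee π bounded | suc w =
  trans (isPositive-⊖ (above (suc w) π) (suc w))
        (<ᵇ-agree (suc w)
          (λ a≤ → part⇒durfee≤ 0 (suc w) π (above≤⇒part (suc w) (suc w) π bounded a≤))
          (λ d≤ → part⇒above≤ (suc w) (suc w) π bounded (durfee≤⇒part 0 (suc w) π bounded d≤)))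

lowerDurfee : ℕ → List ℕ → List ℕ
lowerDurfee j []       = []
lowerDurfee j (x ∷ xs) = if j <ᵇ x then pred x ∷ lowerDurfee (suc j) xs else x ∷ xs

raiseDurfee : ℕ → List ℕ → List ℕ
raiseDurfee j []       = []
raiseDurfee j (x ∷ xs) = if j <ᵇ x then suc x ∷ raiseDurfee (suc j) xs else x ∷ xs

misses-step : ∀ {j x xs} → j < x → meets (suc j) (x ∷ xs) ≡ false →
              suc j < x × meets (suc (suc j)) xs ≡ false
misses-step {j} {x} j<x miss with suc j <ᵇ x | <ᵇ-reflects-< (suc j) x
... | true  | ofʸ 1+j<x = 1+j<x , miss
... | false | ofⁿ 1+j≮x with refl ← ≤-antisym (≮⇒≥ 1+j≮x) j<x =
  contradiction (trans (sym (≡ᵇ-refl (suc j))) miss) λ ()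

durfee-step : ∀ {j x xs} → j < x → durfee j (x ∷ xs) ≡ suc (durfee (suc j) xs)
durfee-step j<x rewrite <ᵇ-true j<x = refl

raise-step : ∀ {j x xs} → j < x → raiseDurfee j (x ∷ xs) ≡ suc x ∷ raiseDurfee (suc j) xs
raise-step j<x rewrite <ᵇ-true j<x = refl

durfee-lower : ∀ j λs → meets (suc j) λs ≡ false → durfee j (lowerDurfee j λs) ≡ durfee j λs
durfee-lower j [] _ = refl
durfee-lower j (x ∷ xs) miss with j <ᵇ x | <ᵇ-reflects-< j x
... | false | ofⁿ j≮x rewrite <ᵇ-false (≮⇒≥ j≮x) = refl
... | true  | ofʸ j<x with misses-step {xs = xs} j<x miss
...   | s≤s j<x' , miss' = trans (durfee-step {xs = lowerDurfee (suc j) xs} j<x') (cong suc (durfee-lower (suc j) xs miss'))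

lower-bounded : ∀ {c} j λs → j ≤ c → Bounded (suc c) λs → meets (suc j) λs ≡ false →
                Bounded c (lowerDurfee j λs)
lower-bounded j [] _ bnil _ = bnil
lower-bounded j (x ∷ xs) j≤c (bcons p x≤ r) miss with j <ᵇ x | <ᵇ-reflects-< j x
... | false | ofⁿ j≮x = bcons p (≤-trans (≮⇒≥ j≮x) j≤c) r
... | true  | ofʸ j<x with misses-step {xs = xs} j<x miss
...   | s≤s j<x' , miss' = bcons (≤-trans (s≤s z≤n) j<x') (≤-pred x≤) (lower-bounded (suc j) xs j<x' r miss')

raise-lower : ∀ j λs → meets (suc j) λs ≡ false → raiseDurfee j (lowerDurfee j λs) ≡ λs
raise-lower j [] _ = refl
raise-lower j (x ∷ xs) miss with j <ᵇ x | <ᵇ-reflects-< j x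
... | false | ofⁿ j≮x rewrite <ᵇ-false (≮⇒≥ j≮x) = refl
... | true  | ofʸ j<x with misses-step {xs = xs} j<x miss
...   | s≤s j<x' , miss' = trans (raise-step {xs = lowerDurfee (suc j) xs} j<x') (cong (x ∷_) (raise-lower (suc j) xs miss'))

lower-sum : ∀ j λs → sum (lowerDurfee j λs) + durfee j λs ≡ sum λs
lower-sum j [] = refl
lower-sum j (x ∷ xs) with j <ᵇ x | <ᵇ-reflects-< j x
... | false | _ = +-identityʳ _
... | true  | ofʸ (s≤s {n = x'} _) = begin
  x' + sum (lowerDurfee (suc j) xs) + suc (durfee (suc j) xs)   ≡⟨ shuffle x' _ _ ⟩
  suc (x' + (sum (lowerDurfee (suc j) xs) + durfee (suc j) xs)) ≡⟨ cong (λ s → suc (x' + s)) (lower-sum (suc j) xs) ⟩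
  suc (x' + sum xs)                                             ∎
  where
  open ≡-Reasoning
  shuffle : ∀ a b c → a + b + suc c ≡ suc (a + (b + c))
  shuffle = solve 3 (λ a b c → a :+ b :+ (con 1 :+ c) := con 1 :+ (a :+ (b :+ c))) refl
    where open +-*-Solver

length-lower : ∀ j λs → length (lowerDurfee j λs) ≡ length λs
length-lower j [] = refl
length-lower j (x ∷ xs) with j <ᵇ x
... | true  = cong suc (length-lower (suc j) xs)
... | false = refl

lower-raise : ∀ j u → lowerDurfee j (raiseDurfee j u) ≡ u
lower-raise j [] = refl
lower-raise j (x ∷ xs) with j <ᵇ x | <ᵇ-reflects-< j x
... | false | ofⁿ j≮x rewrite <ᵇ-false (≮⇒≥ j≮x) = refl
... | true  | ofʸ j<x rewrite <ᵇ-true (m<n⇒m<1+n j<x) = cong (x ∷_) (lower-raise (suc j) xs)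

durfee-raise : ∀ j u → durfee j (raiseDurfee j u) ≡ durfee j u
durfee-raise j [] = refl
durfee-raise j (x ∷ xs) with j <ᵇ x | <ᵇ-reflects-< j x
... | false | ofⁿ j≮x rewrite <ᵇ-false (≮⇒≥ j≮x) = refl
... | true  | ofʸ j<x rewrite <ᵇ-true (m<n⇒m<1+n j<x) = cong suc (durfee-raise (suc j) xs)

raise-sum : ∀ j u → sum (raiseDurfee j u) ≡ sum u + durfee j u
raise-sum j [] = refl
raise-sum j (x ∷ xs) with j <ᵇ x
... | false = sym (+-identityʳ _)
... | true  = begin
  suc (x + sum (raiseDurfee (suc j) xs))     ≡⟨ cong (λ s → suc (x + s)) (raise-sum (suc j) xs) ⟩
  suc (x + (sum xs + durfee (suc j) xs))     ≡⟨ shuffle x (sum xs) _ ⟩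
  x + sum xs + suc (durfee (suc j) xs)       ∎
  where
  open ≡-Reasoning
  shuffle : ∀ a b c → suc (a + (b + c)) ≡ a + b + suc c
  shuffle = solve 3 (λ a b c → con 1 :+ (a :+ (b :+ c)) := a :+ b :+ (con 1 :+ c)) refl
    where open +-*-Solver

raise-bounded : ∀ {b} j u → Bounded b u → Bounded (suc b) (raiseDurfee j u)
raise-bounded j [] bnil = bnil
raise-bounded j (x ∷ xs) (bcons p x≤b r) with j <ᵇ x
... | true  = bcons (s≤s z≤n) (s≤s x≤b) (raise-bounded (suc j) xs r)
... | false = bcons p (≤-trans x≤b (n≤1+n _)) r

raise-misses : ∀ j u → meets (suc j) (raiseDurfee j u) ≡ false
raise-misses j [] = refl
raise-misses j (x ∷ xs) with j <ᵇ x | <ᵇ-reflects-< j x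
... | true  | ofʸ j<x rewrite <ᵇ-true j<x = raise-misses (suc j) xs
... | false | ofⁿ j≮x rewrite <ᵇ-false {suc j} {x} (≤-trans (≮⇒≥ j≮x) (n≤1+n j)) =
  ≡ᵇ-false (<⇒≢ (s≤s (≮⇒≥ j≮x)))

durfee-++-ones : ∀ j u c → 1 ≤ j + length u → durfee j (u ++ replicate c 1) ≡ durfee j u
durfee-++-ones j []      zero    _   = refl
durfee-++-ones j []      (suc c) 1≤j rewrite <ᵇ-false {j} {1} (subst (1 ≤_) (+-identityʳ j) 1≤j) = refl
durfee-++-ones j (x ∷ u) c       _   with j <ᵇ x
... | true  = cong suc (durfee-++-ones (suc j) u c (s≤s z≤n))
... | false = refl

ones-replicate : ∀ d → ones (replicate d 1) ≡ d
ones-replicate zero    = refl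
ones-replicate (suc d) = cong suc (ones-replicate d)

all-ones : ∀ {xs} → Bounded 1 xs → xs ≡ replicate (ones xs) 1
all-ones bnil = refl
all-ones (bcons 1≤x x≤1 r) with refl ← ≤-antisym x≤1 1≤x = cong (1 ∷_) (all-ones r)

ones-suffix : ∀ {b} κ d → Bounded b κ → d ≤ ones κ → Σ (List ℕ) λ u → κ ≡ u ++ replicate d 1
ones-suffix [] .zero bnil z≤n = [] , refl
ones-suffix (x ∷ xs) d (bcons _ _ r) d≤ with x ≡ᵇ 1 in isOne
... | false = let u , eq = ones-suffix xs d r d≤ in x ∷ u , cong (x ∷_) eq
... | true with refl ← ≡ᵇ⇒≡ x 1 (Equivalence.from T-≡ isOne) with d ℕ.≤? ones xs
...   | yes d≤ones = let u , eq = ones-suffix xs d r d≤ones in 1 ∷ u , cong (1 ∷_) eq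
...   | no d≰ones with refl ← ≤-antisym d≤ (≰⇒> d≰ones) = [] , cong (1 ∷_) (all-ones r)

dropLast : ℕ → List ℕ → List ℕ
dropLast d xs = take (length xs ∸ d) xs

dropLast-++ : ∀ u d → dropLast d (u ++ replicate d 1) ≡ u
dropLast-++ u d rewrite length-++ u {replicate d 1} | length-replicate d {1} | m+n∸n≡m (length u) d =
  take-length u
  where
  take-length : ∀ u {v} → take (length u) (u ++ v) ≡ u
  take-length []      = refl
  take-length (x ∷ u) = cong (x ∷_) (take-length u)

trailing-ones : ∀ {b} κ d → Bounded b κ → d ≤ ones κ → κ ≡ dropLast d κ ++ replicate d 1
trailing-ones κ d bounded d≤ with u , refl ← ones-suffix κ d bounded d≤ =
  cong (_++ replicate d 1) (sym (dropLast-++ u d))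

-- Shaving takes one cell from each row of the Durfee square and appends that
-- many parts 1; it preserves the size and the Durfee square.
shave : List ℕ → List ℕ
shave λs = lowerDurfee 0 λs ++ replicate (durfee 0 λs) 1

unshave : List ℕ → List ℕ
unshave κ = raiseDurfee 0 (dropLast (durfee 0 κ) κ)

nonempty : ∀ xs → 1 ≤ sum xs → 1 ≤ length xs
nonempty (_ ∷ _) _ = s≤s z≤n

shave-durfee : ∀ λs → 1 ≤ sum λs → meets 1 λs ≡ false → durfee 0 (shave λs) ≡ durfee 0 λs
shave-durfee λs 1≤sum miss =
  trans (durfee-++-ones 0 (lowerDurfee 0 λs) (durfee 0 λs)
          (subst (1 ≤_) (sym (length-lower 0 λs)) (nonempty λs 1≤sum)))
        (durfee-lower 0 λs miss)

shave-partition : ∀ {n λs} → 2 ≤ n → λs ∈ partitions n → meets 1 λs ≡ false →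
                  shave λs ∈ partitions n × positiveCrank (shave λs) ≡ false
shave-partition {suc c} {λs} (s≤s 1≤c) λs∈ miss =
  partitions-complete bounded sumShave ,
  trans (positiveCrank-durfee (shave λs) bounded) (<ᵇ-false durfee≤ones)
  where
  d : ℕ
  d = durfee 0 λs
  sound : Bounded (suc c) λs × sum λs ≡ suc c
  sound = partitions-sound (suc c) λs∈
  bounded : Bounded c (shave λs)
  bounded = Bounded-++-ones (lowerDurfee 0 λs) d (lower-bounded 0 λs z≤n (proj₁ sound) miss) 1≤c
  sumShave : sum (shave λs) ≡ suc c
  sumShave = begin
    sum (lowerDurfee 0 λs ++ replicate d 1)    ≡⟨ sum-++ (lowerDurfee 0 λs) (replicate d 1) ⟩
    sum (lowerDurfee 0 λs) + sum (replicate d 1) ≡⟨ cong (_+_ (sum (lowerDurfee 0 λs))) (sum-ones d) ⟩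
    sum (lowerDurfee 0 λs) + d                 ≡⟨ lower-sum 0 λs ⟩
    sum λs                                     ≡⟨ proj₂ sound ⟩
    suc c                                      ∎
    where open ≡-Reasoning
  durfee≤ones : durfee 0 (shave λs) ≤ ones (shave λs)
  durfee≤ones = begin
    durfee 0 (shave λs)                                ≡⟨ shave-durfee λs (subst (1 ≤_) (sym (proj₂ sound)) (s≤s z≤n)) miss ⟩
    d                                                  ≤⟨ m≤n+m d _ ⟩
    ones (lowerDurfee 0 λs) + d                        ≡⟨ cong (_+_ (ones (lowerDurfee 0 λs))) (ones-replicate d) ⟨
    ones (lowerDurfee 0 λs) + ones (replicate d 1)     ≡⟨ countBy-++ _ (lowerDurfee 0 λs) (replicate d 1) ⟨
    ones (shave λs)                                    ∎
    where open ≤-Reasoning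

unshave-shave : ∀ λs → 1 ≤ sum λs → meets 1 λs ≡ false → unshave (shave λs) ≡ λs
unshave-shave λs 1≤sum miss rewrite shave-durfee λs 1≤sum miss =
  trans (cong (raiseDurfee 0) (dropLast-++ (lowerDurfee 0 λs) (durfee 0 λs))) (raise-lower 0 λs miss)

-- A list of d ≥ 2 parts 1 has Durfee square 1, so a list of size ≥ 2 that is
-- v followed by as many parts 1 as its Durfee square has a nonempty v.
ones-prefix-nonempty : ∀ v d → 2 ≤ sum (v ++ replicate d 1) → durfee 0 (v ++ replicate d 1) ≡ d →
                       1 ≤ length v
ones-prefix-nonempty (_ ∷ _) _             _  _  = s≤s z≤n
ones-prefix-nonempty []      zero          () _
ones-prefix-nonempty []      (suc zero)    (s≤s ()) _
ones-prefix-nonempty []      (suc (suc _)) _  ()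

unshave-partition : ∀ {n κ} → 2 ≤ n → κ ∈ partitions n → positiveCrank κ ≡ false →
  unshave κ ∈ partitions n × meets 1 (unshave κ) ≡ false × shave (unshave κ) ≡ κ
unshave-partition {n} {κ} 2≤n κ∈ nonPositive =
  partitions-complete (raise-bounded 0 u boundedU) sumUnshave , raise-misses 0 u , reshave
  where
  bounded : Bounded n κ
  bounded = proj₁ (partitions-sound n κ∈)
  sumκ : sum κ ≡ n
  sumκ = proj₂ (partitions-sound n κ∈)
  d : ℕ
  d = durfee 0 κ
  u : List ℕ
  u = dropLast d κ
  κ≡ : κ ≡ u ++ replicate d 1
  κ≡ = trailing-ones κ d bounded (<ᵇ-false⁻ (trans (sym (positiveCrank-durfee κ bounded)) nonPositive))
  durfeeU : durfee 0 u ≡ d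
  durfeeU = trans (sym (durfee-++-ones 0 u d
                         (ones-prefix-nonempty u d (subst (λ v → 2 ≤ sum v) κ≡ (subst (2 ≤_) (sym sumκ) 2≤n))
                                        (cong (durfee 0) (sym κ≡)))))
                  (cong (durfee 0) (sym κ≡))
  boundedU : Bounded n u
  boundedU = Bounded-prefix u (replicate d 1) (subst (Bounded n) κ≡ bounded)
  sumUnshave : sum (raiseDurfee 0 u) ≡ n
  sumUnshave = begin
    sum (raiseDurfee 0 u)       ≡⟨ raise-sum 0 u ⟩
    sum u + durfee 0 u          ≡⟨ cong (_+_ (sum u)) (trans durfeeU (sym (sum-ones d))) ⟩
    sum u + sum (replicate d 1) ≡⟨ sum-++ u (replicate d 1) ⟨
    sum (u ++ replicate d 1)    ≡⟨ cong sum κ≡ ⟨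
    sum κ                       ≡⟨ sumκ ⟩
    n                           ∎
    where open ≡-Reasoning
  reshave : shave (raiseDurfee 0 u) ≡ κ
  reshave = trans (cong₂ _++_ (lower-raise 0 u) (cong (λ t → replicate t 1) (trans (durfee-raise 0 u) durfeeU)))
                  (sym κ≡)

positiveCrank-count : ∀ n → 2 ≤ n → countBy positiveCrank (partitions n) ≡ hitCount 0 n
positiveCrank-count n 2≤n = +-cancelʳ-≡ (countBy (not ∘ meets 1) (partitions n)) _ _ (begin
  countBy positiveCrank P + countBy (not ∘ meets 1) P        ≡⟨ cong (_+_ (countBy positiveCrank P)) shave-bijection ⟩
  countBy positiveCrank P + countBy (not ∘ positiveCrank) P  ≡⟨ countBy-complement positiveCrank P ⟩
  length P                                                   ≡⟨ countBy-complement (meets 1) P ⟨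
  hitCount 0 n + countBy (not ∘ meets 1) P                   ∎)
  where
  open ≡-Reasoning
  P : List (List ℕ)
  P = partitions n
  size≥1 : ∀ {λs} → λs ∈ P → 1 ≤ sum λs
  size≥1 λs∈ = subst (1 ≤_) (sym (proj₂ (partitions-sound n λs∈))) (≤-trans (s≤s z≤n) 2≤n)
  shave-bijection : countBy (not ∘ meets 1) P ≡ countBy (not ∘ positiveCrank) P
  shave-bijection = countBy-bijection _ _ (partitions-unique n) (partitions-unique n) shave unshave
    (λ λs∈ miss → let shave∈ , nonPositive = shave-partition 2≤n λs∈ (Equivalence.to T-not-≡ miss)
                   in shave∈ , Equivalence.from T-not-≡ nonPositive)
    (λ κ∈ nonPositive → let unshave∈ , miss , _ = unshave-partition 2≤n κ∈ (Equivalence.to T-not-≡ nonPositive)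
                         in unshave∈ , Equivalence.from T-not-≡ miss)
    (λ λs∈ miss → unshave-shave _ (size≥1 λs∈) (Equivalence.to T-not-≡ miss))
    (λ κ∈ nonPositive → proj₂ (proj₂ (unshave-partition 2≤n κ∈ (Equivalence.to T-not-≡ nonPositive))))

inRange : ℕ → ℤ → Bool
inRange b (+ k)    = (1 ≤ᵇ k) ∧ (k ≤ᵇ b)
inRange b -[1+ _ ] = false

⌊⌋-does : ∀ {P : Set} (P? : Dec P) → ⌊ P? ⌋ ≡ does P?
⌊⌋-does (true  because _) = refl
⌊⌋-does (false because _) = refl

<ᵇ-suc : ∀ k b → indicator (k <ᵇ suc b) ≡ indicator (k <ᵇ b) + indicator (k ≡ᵇ b)
<ᵇ-suc zero    zero    = refl
<ᵇ-suc zero    (suc b) = refl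
<ᵇ-suc (suc k) zero    = refl
<ᵇ-suc (suc k) (suc b) = <ᵇ-suc k b

inRange-suc : ∀ b z → indicator (inRange (suc b) z) ≡ indicator (inRange b z) + indicator ⌊ z ℤ.≟ + suc b ⌋
inRange-suc b -[1+ _ ] = refl
inRange-suc b (+ zero) rewrite ⌊⌋-does (+ zero ℤ.≟ + suc b) = refl
inRange-suc b (+ suc k) rewrite ⌊⌋-does (+ suc k ℤ.≟ + suc b) = <ᵇ-suc k b

sum-Mcomb : ∀ b n → sumFrom1 b (λ m → Mcomb (+ m) n) ≡ + countBy (inRange b ∘ crank) (partitions n)
sum-Mcomb zero n = cong +_ (sym (countBy-none (inRange 0 ∘ crank) (partitions n) λ {π} _ → empty (crank π)))
  where
  empty : ∀ z → ¬ T (inRange 0 z)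
  empty (+ zero)    ()
  empty (+ suc _)   ()
  empty -[1+ _ ]    ()
sum-Mcomb (suc b) n = begin
  sumFrom1 b (λ m → Mcomb (+ m) n) ℤ.+ Mcomb (+ suc b) n
    ≡⟨ cong (ℤ._+ Mcomb (+ suc b) n) (sum-Mcomb b n) ⟩
  + countBy (inRange b ∘ crank) P ℤ.+ + countBy (λ π → ⌊ crank π ℤ.≟ + suc b ⌋) P
    ≡⟨ ℤ.pos-+ (countBy (inRange b ∘ crank) P) (countBy (λ π → ⌊ crank π ℤ.≟ + suc b ⌋) P) ⟨
  + (countBy (inRange b ∘ crank) P + countBy (λ π → ⌊ crank π ℤ.≟ + suc b ⌋) P)
    ≡⟨ cong +_ (countBy-split _ _ _ P (inRange-suc b ∘ crank)) ⟨
  + countBy (inRange (suc b) ∘ crank) P ∎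
  where
  open ≡-Reasoning
  P : List (List ℕ)
  P = partitions n

-- The crank of a partition is at most its size: the largest part and the
-- number of parts are, and so is a difference a − c bounded by a.
largest-≤-sum : ∀ xs → largest xs ≤ sum xs
largest-≤-sum []       = z≤n
largest-≤-sum (x ∷ xs) = ⊔-lub (m≤m+n x (sum xs)) (≤-trans (largest-≤-sum xs) (m≤n+m (sum xs) x))

length-≤-sum : ∀ {b} xs → Bounded b xs → length xs ≤ sum xs
length-≤-sum []       bnil          = z≤n
length-≤-sum (x ∷ xs) (bcons p _ r) = +-mono-≤ p (length-≤-sum xs r)

⊖-≤-left : ∀ a c k → a ⊖ c ≡ + k → k ≤ a
⊖-≤-left zero    zero    .zero refl = z≤n
⊖-≤-left (suc a) zero    _     refl = ≤-refl
⊖-≤-left (suc a) (suc c) k     eq   =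
  m≤n⇒m≤1+n (⊖-≤-left a c k (trans (sym (ℤ.[1+m]⊖[1+n]≡m⊖n a c)) eq))

crank-≤-sum : ∀ {b} π → Bounded b π → ∀ k → crank π ≡ + k → k ≤ sum π
crank-≤-sum π bounded k eq with count (λ x → x ≡ᵇ 1) π
... | zero with refl ← eq = largest-≤-sum π
... | suc w = ≤-trans (⊖-≤-left _ (suc w) k eq) (≤-trans (length-filter _ π) (length-≤-sum π bounded))

inRange-crank : ∀ n π → π ∈ partitions n → inRange n (crank π) ≡ positiveCrank π
inRange-crank n π π∈ with crank π in eq
... | -[1+ _ ] = refl
... | + zero   = refl
... | + suc k  = Equivalence.to T-≡ (≤⇒≤ᵇ (subst (suc k ≤_) sumπ (crank-≤-sum π bounded (suc k) eq)))
  where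
  bounded : Bounded n π
  bounded = proj₁ (partitions-sound n π∈)
  sumπ : sum π ≡ n
  sumπ = proj₂ (partitions-sound n π∈)

-- D(n) is the number of partitions of n meeting diagonal 1 (also for n ≤ 1,
-- thanks to the Andrews–Garvan normalisation of M(m, 1))
D-hitCount : ∀ n → D n ≡ + hitCount 0 n
D-hitCount zero          = refl
D-hitCount (suc zero)    = refl
D-hitCount n@(suc (suc _)) = begin
  sumFrom1 n (λ m → Mcomb (+ m) n)                ≡⟨ sum-Mcomb n n ⟩
  + countBy (inRange n ∘ crank) (partitions n)    ≡⟨ cong +_ (countBy-cong _ _ (partitions n) (inRange-crank n _)) ⟩
  + countBy positiveCrank (partitions n)          ≡⟨ cong +_ (positiveCrank-count n (s≤s (s≤s z≤n))) ⟩
  + hitCount 0 n                                  ∎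
  where open ≡-Reasoning

tri-suc : ∀ j → tri (suc j) ≡ tri j + suc j
tri-suc j = begin
  suc j ℕ.* suc (suc j) / 2             ≡⟨ cong (_/ 2) (expand j) ⟩
  (j ℕ.* suc j + suc j ℕ.* 2) / 2       ≡⟨ +-distrib-/-∣ʳ (j ℕ.* suc j) (divides (suc j) refl) ⟩
  tri j + suc j ℕ.* 2 / 2               ≡⟨ cong (_+_ (tri j)) (m*n/n≡m (suc j) 2) ⟩
  tri j + suc j                         ∎
  where
  open ≡-Reasoning
  expand : ∀ j → suc j ℕ.* suc (suc j) ≡ j ℕ.* suc j + suc j ℕ.* 2
  expand = solve 1 (λ j → (con 1 :+ j) :* (con 2 :+ j) := j :* (con 1 :+ j) :+ (con 1 :+ j) :* con 2) refl
    where open +-*-Solver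

hitCountℤ : ℕ → ℤ → ℕ
hitCountℤ m (+ n)    = hitCount m n
hitCountℤ m -[1+ _ ] = 0

-- the recursion of hitCount, valid for every integer size N: for N ≥ m + 1
-- it is hitCount-recursion, for 0 ≤ N ≤ m all three terms vanish (the first by
-- hitCount-small, the others having negative size), and likewise for N < 0
hitCountℤ-recursion : ∀ m N → hitCountℤ m N + hitCountℤ (suc m) (N - + suc m) ≡ pℤ (N - + suc m)
hitCountℤ-recursion m -[1+ _ ] = refl
hitCountℤ-recursion m (+ N) rewrite ℤ.m-n≡m⊖n N (suc m) with suc m ℕ.≤? N
... | yes m<N with M , refl ← m≤n⇒∃[o]m+o≡n m<N
  rewrite ℤ.⊖-≥ m<N | m+n∸m≡n (suc m) M = hitCount-recursion m M
... | no m≮N rewrite ℤ.⊖-< (≰⇒> m≮N) with suc m ∸ N | m<n⇒0<n∸m (≰⇒> m≮N)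
...   | suc _ | _ = trans (+-identityʳ _) (hitCount-small m N (≰⇒> m≮N))

remainder : ℕ → ℕ → ℕ
remainder n k = hitCountℤ k (+ n - + tri k)

remainder-recursion : ∀ n k → remainder n k + remainder n (suc k) ≡ pℤ (+ n - + tri (suc k))
remainder-recursion n k =
  subst (λ N → remainder n k + hitCountℤ (suc k) N ≡ pℤ N) (sym shift) (hitCountℤ-recursion k (+ n - + tri k))
  where
  shift : + n - + tri (suc k) ≡ (+ n - + tri k) - + suc k
  shift = begin
    + n - + tri (suc k)             ≡⟨ cong (λ t → + n - + t) (tri-suc k) ⟩
    + n - + (tri k + suc k)         ≡⟨ cong (λ t → + n - t) (ℤ.pos-+ (tri k) (suc k)) ⟩
    + n - (+ tri k ℤ.+ + suc k)     ≡⟨ sub-assoc (+ n) (+ tri k) (+ suc k) ⟩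
    (+ n - + tri k) - + suc k       ∎
    where
    open ≡-Reasoning
    sub-assoc : ∀ a b c → a - (b ℤ.+ c) ≡ (a - b) - c
    sub-assoc = solve 3 (λ a b c → a :- (b :+ c) := (a :- b) :- c) refl
      where open ℤSolver

remainder-positive : ∀ n k → tri (suc k) ≤ n → 1 ≤ remainder n k
remainder-positive n k T≤n = subst (1 ≤_) (sym remainder≡) (hitCount-positive k (n ∸ tri k) k<)
  where
  T+≤n : tri k + suc k ≤ n
  T+≤n = subst (_≤ n) (tri-suc k) T≤n
  remainder≡ : remainder n k ≡ hitCount k (n ∸ tri k)
  remainder≡ = cong (hitCountℤ k) (trans (ℤ.m-n≡m⊖n n (tri k)) (ℤ.⊖-≥ (≤-trans (m≤m+n (tri k) (suc k)) T+≤n)))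
  ∸-+-shift : n ∸ tri k ≡ suc k + (n ∸ (tri k + suc k))
  ∸-+-shift = begin
    n ∸ tri k                                 ≡⟨ cong (_∸ tri k) (m+[n∸m]≡n T+≤n) ⟨
    (tri k + suc k) + (n ∸ (tri k + suc k)) ∸ tri k ≡⟨ cong (_∸ tri k) (+-assoc (tri k) (suc k) _) ⟩
    tri k + (suc k + (n ∸ (tri k + suc k))) ∸ tri k ≡⟨ m+n∸m≡n (tri k) _ ⟩
    suc k + (n ∸ (tri k + suc k))             ∎
    where open ≡-Reasoning
  k< : suc k ≤ n ∸ tri k
  k< = subst (suc k ≤_) (sym ∸-+-shift) (m≤m+n (suc k) _)

D-telescope : ∀ n k → D n ≡ S n k ℤ.+ (-[1+ 0 ] ^ k) * + remainder n k
D-telescope n zero = begin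
  D n                                    ≡⟨ D-hitCount n ⟩
  + hitCount 0 n                         ≡⟨ cong (λ N → + hitCountℤ 0 N) (ℤ.+-identityʳ (+ n)) ⟨
  + remainder n 0                        ≡⟨ ℤ.*-identityˡ _ ⟨
  + 1 * + remainder n 0                  ≡⟨ ℤ.+-identityˡ _ ⟨
  + 0 ℤ.+ + 1 * + remainder n 0          ∎
  where open ≡-Reasoning
D-telescope n (suc k) = begin
  D n                                                  ≡⟨ D-telescope n k ⟩
  S n k ℤ.+ s * + remainder n k                        ≡⟨ cong (λ r → S n k ℤ.+ s * r) remainder≡ ⟩
  S n k ℤ.+ s * (+ pₖ - + remainder n (suc k))         ≡⟨ regroup (S n k) s (+ pₖ) (+ remainder n (suc k)) ⟩
  (S n k ℤ.+ s * + pₖ) ℤ.+ (-[1+ 0 ] * s) * + remainder n (suc k) ∎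
  where
  open ≡-Reasoning
  s : ℤ
  s = -[1+ 0 ] ^ k
  pₖ : ℕ
  pₖ = pℤ (+ n - + tri (suc k))
  add-sub : ∀ a b → a ≡ a ℤ.+ b - b
  add-sub = solve 2 (λ a b → a := a :+ b :- b) refl
    where open ℤSolver
  remainder≡ : + remainder n k ≡ + pₖ - + remainder n (suc k)
  remainder≡ = begin
    + remainder n k                                         ≡⟨ add-sub (+ remainder n k) (+ remainder n (suc k)) ⟩
    + remainder n k ℤ.+ + remainder n (suc k) - + remainder n (suc k)
                                                            ≡⟨ cong (_- + remainder n (suc k)) (ℤ.pos-+ (remainder n k) _) ⟨
    + (remainder n k + remainder n (suc k)) - + remainder n (suc k)
                                                            ≡⟨ cong (λ t → + t - + remainder n (suc k)) (remainder-recursion n k) ⟩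
    + pₖ - + remainder n (suc k)                            ∎
  regroup : ∀ a s p r → a ℤ.+ s * (p - r) ≡ (a ℤ.+ s * p) ℤ.+ (-[1+ 0 ] * s) * r
  regroup = solve 4 (λ a s p r → a :+ s :* (p :- r) := (a :+ s :* p) :+ (con -[1+ 0 ] :* s) :* r) refl
    where open ℤSolver

sign-square : ∀ k → (-[1+ 0 ] ^ k) * (-[1+ 0 ] ^ k) ≡ + 1
sign-square zero    = refl
sign-square (suc k) = trans (negate-both (-[1+ 0 ] ^ k)) (sign-square k)
  where
  negate-both : ∀ a → (-[1+ 0 ] * a) * (-[1+ 0 ] * a) ≡ a * a
  negate-both = solve 1 (λ a → (con -[1+ 0 ] :* a) :* (con -[1+ 0 ] :* a) := a :* a) refl
    where open ℤSolver

signed-gap : ∀ n k → (-[1+ 0 ] ^ k) * (S n (suc k) - D n) ≡ + remainder n (suc k)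
signed-gap n k = begin
  s * (S n (suc k) - D n)                                   ≡⟨ cong (λ d → s * (S n (suc k) - d)) (D-telescope n (suc k)) ⟩
  s * (S n (suc k) - (S n (suc k) ℤ.+ (-[1+ 0 ] * s) * r))  ≡⟨ cancel (S n (suc k)) s r ⟩
  (s * s) * r                                               ≡⟨ cong (_* r) (sign-square k) ⟩
  + 1 * r                                                   ≡⟨ ℤ.*-identityˡ r ⟩
  r                                                         ∎
  where
  open ≡-Reasoning
  s : ℤ
  s = -[1+ 0 ] ^ k
  r : ℤ
  r = + remainder n (suc k)
  cancel : ∀ a s r → s * (a - (a ℤ.+ (-[1+ 0 ] * s) * r)) ≡ (s * s) * r
  cancel = solve 3 (λ a s r → s :* (a :- (a :+ (con -[1+ 0 ] :* s) :* r)) := (s :* s) :* r) refl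
    where open ℤSolver

corollary4p6 : (n k : ℕ) → 1 ≤ k →
    (+ 0 ℤ.≤ (-[1+ 0 ] ^ (k ∸ 1)) * (S n k - D n))
    × (tri (suc k) ≤ n → + 0 ℤ.< (-[1+ 0 ] ^ (k ∸ 1)) * (S n k - D n))
corollary4p6 n (suc k) _ rewrite signed-gap n k =
  ℤ.+≤+ z≤n , λ T≤n → ℤ.+<+ (remainder-positive n (suc k) T≤n)
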